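{- Let $s\ge 2$ be an integer and let $p\ge 3$ be an odd prime. Then there exist integers $s'=s'(s,p)$ and $d'=d'(s,p)$ with $1\le d'\le p$ such that for every positive integer $n$, $$\nu_p(f_n(s,-1))=\delta_{d'\mathbb{Z}}(n)\,\nu_p\!\left(\frac{s'n}{d'}\right).$$
   Context: For integers $s,t$, the generalized Fibonacci sequence is $f_0(s,t)=0$, $f_1(s,t)=1$, $f_n(s,t)=s f_{n-1}(s,t)+t f_{n-2}(s,t)$ for $n\ge2$. $\nu_p$ is the $p$-adic valuation (extended to nonzero rationals). For a positive integer $d'$, $\delta_{d'\mathbb{Z}}(n)$ equals $1$ if $d'\mid n$ and $0$ otherwise. -}

module Defs where

open import Data.Nat as ℕ using (ℕ; zero; suc)
open import Data.Nat.Divisibility using (_∣?_)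
open import Data.Integer as ℤ using (ℤ; +_; -_; _-_; ∣_∣)
open import Data.Product using (Σ; _×_; ∃; ∃-syntax)
open import Relation.Nullary using (¬_; does)
open import Relation.Binary.PropositionalEquality using (_≡_)
open import Data.Bool using (if_then_else_)

fib : ℤ → ℤ → ℕ → ℤ
fib s t zero = + 0
fib s t (suc zero) = + 1
fib s t (suc (suc n)) = s ℤ.* fib s t (suc n) ℤ.+ t ℤ.* fib s t n

-- p-adic valuation of a nonzero integer, as a relation:
-- IsVal p x k  iff  p^k ∣ x and p^(k+1) ∤ x  (no k exists when x = 0)
IsVal : ℕ → ℤ → ℕ → Set
IsVal p x k = (p ℕ.^ k) Data.Nat.Divisibility.∣ ∣ x ∣
            × ¬ ((p ℕ.^ suc k) Data.Nat.Divisibility.∣ ∣ x ∣)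

-- p-adic valuation of the nonzero rational a / b (a, b nonzero integers):
-- ν_p(a/b) = ν_p(a) - ν_p(b)
IsValQ : ℕ → ℤ → ℤ → ℤ → Set
IsValQ p a b v = ∃[ i ] ∃[ j ] (IsVal p a i × IsVal p b j × v ≡ + i - + j)

δ : ℕ → ℕ → ℕ
δ d n = if does (d ∣? n) then 1 else 0

module Submission where

-- The witnesses are d′ = d, the rank of apparition of p (least d ≥ 1 with
-- p ∣ F(d)), and s′ = F(d).  Three facts combine:
--  * d ≤ p: among F(1), …, F((p+1)/2) either one is divisible by p, or two
--    have equal or opposite residues and p ∣ F(b)² - F(a)² = F(a+b) F(b-a);
--  * p ∣ F(n) iff d ∣ n, by the addition formula and Cassini's identity;
--  * lifting the exponent: for x = F(m), y = F(m+1) with p ∣ x, the expansion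
--    2y² F(km) = x (k (2y^(k+1) - (k-1) s y^k x) + x² X) gives
--    ν_p(F(km)) = ν_p(F(m)) + ν_p(k) when ν_p(k) ≤ 1; peeling off the factors
--    p of q one at a time then gives ν_p(F(qd)) = ν_p(F(d)) + ν_p(q).
-- So ν_p(F(n)) = 0 if d ∤ n and ν_p(F(qd)) = ν_p(F(d) · qd) - ν_p(d).

open import Defs
open import Data.Nat as ℕ using (ℕ; zero; suc; _≤_; _<_; _≥_; z≤n; s≤s; NonZero)
import Data.Nat.Properties as ℕP
open import Data.Nat.Divisibility as ℕD using (divides)
open import Data.Nat.Induction using (<-rec)
open import Data.Nat.Primality using (Prime; euclidsLemma; prime⇒nonZero; prime⇒nonTrivial)
open import Data.Nat.Tactic.RingSolver as ℕRing using ()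
open import Data.Integer as ℤ using (ℤ; +_; -_; ∣_∣)
import Data.Integer.Properties as ℤP
import Data.Integer.Divisibility.Signed as ℤS
open import Data.Integer.Tactic.RingSolver using (solve-∀)
open import Data.Product using (_×_; _,_; ∃-syntax; proj₁; proj₂)
open import Data.Sum using (_⊎_; inj₁; inj₂)
open import Data.Empty using (⊥; ⊥-elim)
open import Relation.Nullary using (¬_; Dec; yes; no)
open import Relation.Nullary.Decidable using (dec-true; dec-false)
open import Relation.Binary.PropositionalEquality
  using (_≡_; _≢_; refl; sym; trans; cong; cong₂; subst; subst₂; module ≡-Reasoning)
open import Relation.Binary.Definitions using (tri<; tri≈; tri>)

-- Since ∣ + n ∣ reduces
-- to n, `IsVal p (+ n) k` is the valuation of a natural number and
-- `IsVal p x k` is by definition `IsVal p (+ ∣ x ∣) k`.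
module Valuation where

  open import Data.Nat using (_+_; _*_; _^_)
  open import Data.Nat.Divisibility using (_∣_)

  prime>1 : ∀ {p} → Prime p → 1 < p
  prime>1 {p} pp = ℕ.nonTrivial⇒n>1 p {{prime⇒nonTrivial pp}}

  pow-∣ : ∀ p {i j} → i ≤ j → p ^ i ∣ p ^ j
  pow-∣ p {zero}  _         = ℕD.1∣ _
  pow-∣ p {suc i} (s≤s i≤j) = ℕD.*-monoʳ-∣ p (pow-∣ p i≤j)

  val-unique : ∀ {p x i j} → IsVal p x i → IsVal p x j → i ≡ j
  val-unique {p} {_} {i} {j} (pⁱ∣x , pⁱ⁺¹∤x) (pʲ∣x , pʲ⁺¹∤x) with ℕP.<-cmp i j
  ... | tri≈ _ i≡j _ = i≡j
  ... | tri< i<j _ _ = ⊥-elim (pⁱ⁺¹∤x (ℕD.∣-trans (pow-∣ p i<j) pʲ∣x))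
  ... | tri> _ _ j<i = ⊥-elim (pʲ⁺¹∤x (ℕD.∣-trans (pow-∣ p j<i) pⁱ∣x))

  val-positive : ∀ {p n i} → IsVal p (+ n) i → 1 ≤ n
  val-positive {n = zero} {i} (_ , pⁱ⁺¹∤0) = ⊥-elim (pⁱ⁺¹∤0 (_ ℕD.∣0))
  val-positive {n = suc _}    _            = s≤s z≤n

  val-intro : ∀ {p} .{{_ : NonZero p}} {n q i} → n ≡ q * p ^ i → ¬ p ∣ q → IsVal p (+ n) i
  val-intro {p} {n} {q} {i} refl p∤q =
    ℕD.n∣m*n q , λ pⁱ⁺¹∣n → p∤q (ℕD.*-cancelʳ-∣ (p ^ i) {{ℕP.m^n≢0 p i}} pⁱ⁺¹∣n)

  val-elim : ∀ {p n i} → IsVal p (+ n) i → ∃[ q ] (n ≡ q * p ^ i × ¬ p ∣ q)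
  val-elim {p} {i = i} (divides q n≡q*pⁱ , pⁱ⁺¹∤n) = q , n≡q*pⁱ , λ p∣q →
    pⁱ⁺¹∤n (subst (p ^ suc i ∣_) (sym n≡q*pⁱ)
             (ℕD.*-monoˡ-∣ (p ^ i) p∣q))

  val-unit : ∀ {p x} .{{_ : NonZero p}} → ¬ p ∣ ∣ x ∣ → IsVal p x 0
  val-unit {x = x} p∤x = val-intro {i = 0} (sym (ℕP.*-identityʳ ∣ x ∣)) p∤x

  val-prime : ∀ {p} → Prime p → IsVal p (+ p) 1
  val-prime {p} pp = val-intro {{prime⇒nonZero pp}} {i = 1} (sym (trans (ℕP.*-identityˡ (p * 1)) (ℕP.*-identityʳ p))) p∤1
    where
    p∤1 : ¬ p ∣ 1
    p∤1 p∣1 = ℕP.<-irrefl (sym (ℕD.∣1⇒≡1 p∣1)) (prime>1 pp)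

  toSigned : ∀ {d x} → d ∣ ∣ x ∣ → + d ℤS.∣ x
  toSigned {d} {x} = ℤS.∣ᵤ⇒∣ {+ d} {x}

  fromSigned : ∀ {d x} → + d ℤS.∣ x → d ∣ ∣ x ∣
  fromSigned {d} {x} = ℤS.∣⇒∣ᵤ {+ d} {x}

  val-+ : ∀ {p x y i} → IsVal p x i → p ^ suc i ∣ ∣ y ∣ → IsVal p (x ℤ.+ y) i
  val-+ {p} {x} {y} {i} (pⁱ∣x , pⁱ⁺¹∤x) pⁱ⁺¹∣y =
    fromSigned {x = x ℤ.+ y} (ℤS.∣m∣n⇒∣m+n (toSigned {x = x} pⁱ∣x) (toSigned {x = y} pⁱ∣y)) ,
    λ pⁱ⁺¹∣x+y → pⁱ⁺¹∤x (fromSigned {x = x}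
      (ℤS.∣m+n∣n⇒∣m (toSigned {x = x ℤ.+ y} pⁱ⁺¹∣x+y) (toSigned {x = y} pⁱ⁺¹∣y)))
    where
    pⁱ∣y : p ^ i ∣ ∣ y ∣
    pⁱ∣y = ℕD.m*n∣⇒n∣ p (p ^ i) pⁱ⁺¹∣y

  module _ {p : ℕ} (pp : Prime p) where
    private instance
      p≢0 : NonZero p
      p≢0 = prime⇒nonZero pp

    val-*ℕ : ∀ {a b i j} → IsVal p (+ a) i → IsVal p (+ b) j → IsVal p (+ (a * b)) (i + j)
    val-*ℕ {a} {b} {i} {j} νa νb
      with qa , a≡ , p∤qa ← val-elim {p} {a} {i} νa | qb , b≡ , p∤qb ← val-elim {p} {b} {j} νb =
      val-intro {q = qa * qb} {i + j} ab≡ p∤qaqb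
      where
      ab≡ : a * b ≡ qa * qb * p ^ (i + j)
      ab≡ = begin
        a * b                           ≡⟨ cong₂ _*_ a≡ b≡ ⟩
        qa * p ^ i * (qb * p ^ j)       ≡⟨ interchange qa (p ^ i) qb (p ^ j) ⟩
        qa * qb * (p ^ i * p ^ j)       ≡⟨ cong (qa * qb *_) (ℕP.^-distribˡ-+-* p i j) ⟨
        qa * qb * p ^ (i + j)           ∎
        where
        open ≡-Reasoning
        interchange : ∀ a b c d → a * b * (c * d) ≡ a * c * (b * d)
        interchange = ℕRing.solve-∀
      p∤qaqb : ¬ p ∣ qa * qb
      p∤qaqb p∣qaqb with euclidsLemma qa qb pp p∣qaqb
      ... | inj₁ p∣qa = p∤qa p∣qa
      ... | inj₂ p∣qb = p∤qb p∣qb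

    val-* : ∀ {x y i j} → IsVal p x i → IsVal p y j → IsVal p (x ℤ.* y) (i + j)
    val-* {x} {y} {i} {j} νx νy =
      subst (λ n → IsVal p (+ n) (i + j)) (sym (ℤP.abs-* x y)) (val-*ℕ {∣ x ∣} {∣ y ∣} {i} {j} νx νy)

    val-peel : ∀ {q e} → IsVal p (+ q) (suc e) → ∃[ q′ ] (q ≡ q′ * p × IsVal p (+ q′) e)
    val-peel {q} {e} νq with c , q≡ , p∤c ← val-elim {p} {q} {suc e} νq =
      c * p ^ e , trans q≡ (reassociate c p (p ^ e)) , val-intro {q = c} {e} refl p∤c
      where
      reassociate : ∀ c p pᵉ → c * (p * pᵉ) ≡ c * pᵉ * p
      reassociate = ℕRing.solve-∀

    val-existsℕ : ∀ n → n ≢ 0 → ∃[ k ] IsVal p (+ n) k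
    val-existsℕ = <-rec _ step
      where
      step : ∀ n → (∀ {m} → m < n → m ≢ 0 → ∃[ k ] IsVal p (+ m) k) → n ≢ 0 → ∃[ k ] IsVal p (+ n) k
      step n rec n≢0 with p ℕD.∣? n
      ... | no  p∤n = 0 , val-unit {x = + n} p∤n
      ... | yes (divides c refl) = suc k , subst (IsVal p (+ (c * p))) (ℕP.+-comm k 1) (val-*ℕ {c} {p} {k} {1} νc (val-prime pp))
        where
        c≢0 : c ≢ 0
        c≢0 refl = n≢0 refl
        c<n : c < c * p
        c<n = ℕP.m<m*n c p {{ℕ.≢-nonZero c≢0}} (prime>1 pp)
        k = proj₁ (rec c<n c≢0)
        νc = proj₂ (rec c<n c≢0)

    val-exists : ∀ x → x ≢ + 0 → ∃[ k ] IsVal p x k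
    val-exists x x≢0 = val-existsℕ ∣ x ∣ (λ ∣x∣≡0 → x≢0 (ℤP.∣i∣≡0⇒i≡0 ∣x∣≡0))

    val-transfer : ∀ {c u x y i j} → IsVal p c 0 → c ℤ.* u ≡ x ℤ.* y →
                   IsVal p x i → IsVal p y j → u ≢ + 0 → IsVal p u (i + j)
    val-transfer {c} {u} {x} {y} {i} {j} νc cu≡xy νx νy u≢0 with val-exists u u≢0
    ... | k , νu = subst (IsVal p u) (val-unique {p} {c ℤ.* u} {k} {i + j} νcu νxy) νu
      where
      νcu : IsVal p (c ℤ.* u) k
      νcu = val-* {c} {u} {0} {k} νc νu
      νxy : IsVal p (c ℤ.* u) (i + j)
      νxy = subst (λ z → IsVal p z (i + j)) (sym cu≡xy) (val-* {x} {y} {i} {j} νx νy)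

module PrimeDivisibility {p : ℕ} (pp : Prime p) where

  open import Data.Integer using (_*_; _^_)
  open import Data.Integer.Divisibility.Signed using (_∣_)
  open Valuation using (prime>1; fromSigned; toSigned)

  euclid : ∀ x y → + p ∣ x * y → (+ p ∣ x) ⊎ (+ p ∣ y)
  euclid x y p∣xy with euclidsLemma ∣ x ∣ ∣ y ∣ pp (subst (p ℕD.∣_) (ℤP.abs-* x y) (fromSigned {x = x * y} p∣xy))
  ... | inj₁ p∣x = inj₁ (toSigned {x = x} p∣x)
  ... | inj₂ p∣y = inj₂ (toSigned {x = y} p∣y)

  ∤1 : ¬ + p ∣ + 1
  ∤1 p∣1 = ℕP.<-irrefl (sym (ℕD.∣1⇒≡1 (fromSigned {x = + 1} p∣1))) (prime>1 pp)

  ∤2 : 3 ≤ p → ¬ + p ∣ + 2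
  ∤2 3≤p p∣2 = ℕP.<-irrefl refl (ℕP.≤-trans 3≤p (ℕD.∣⇒≤ (fromSigned {x = + 2} p∣2)))

  ∤^ : ∀ {y} → ¬ + p ∣ y → ∀ n → ¬ + p ∣ y ^ n
  ∤^ p∤y zero = ∤1
  ∤^ {y} p∤y (suc n) p∣yⁿ⁺¹ with euclid y (y ^ n) p∣yⁿ⁺¹
  ... | inj₁ p∣y  = p∤y p∣y
  ... | inj₂ p∣yⁿ = ∤^ p∤y n p∣yⁿ

  ∤* : ∀ {x y} → ¬ + p ∣ x → ¬ + p ∣ y → ¬ + p ∣ x * y
  ∤* {x} {y} p∤x p∤y p∣xy with euclid x y p∣xy
  ... | inj₁ p∣x = p∤x p∣x
  ... | inj₂ p∣y = p∤y p∣y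

module Identities (s : ℤ) where

  open import Data.Integer using (_+_; _*_; _-_)
  open ≡-Reasoning

  F : ℕ → ℤ
  F = fib s (- + 1)

  F-rec : ∀ n → F (suc (suc n)) ≡ s * F (suc n) - F n
  F-rec n = lemma s (F (suc n)) (F n)
    where
    lemma : ∀ s x y → s * x + (- + 1) * y ≡ s * x - y
    lemma = solve-∀

  F-cassini : ∀ n → F (suc n) * F (suc n) - s * F n * F (suc n) + F n * F n ≡ + 1
  F-cassini zero    = base s
    where
    base : ∀ s → + 1 * + 1 - s * + 0 * + 1 + + 0 * + 0 ≡ + 1
    base = solve-∀
  F-cassini (suc n) = begin
    c * c - s * b * c + b * b                                ≡⟨ cong (λ z → z * z - s * b * z + b * b) (F-rec n) ⟩
    (s * b - a) * (s * b - a) - s * b * (s * b - a) + b * b  ≡⟨ lemma s a b ⟩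
    b * b - s * a * b + a * a                                ≡⟨ F-cassini n ⟩
    + 1                                                      ∎
    where
    a = F n
    b = F (suc n)
    c = F (suc (suc n))
    lemma : ∀ s a b → (s * b - a) * (s * b - a) - s * b * (s * b - a) + b * b ≡ b * b - s * a * b + a * a
    lemma = solve-∀

  F-add : ∀ n a → F (n ℕ.+ a) ≡ F a * F (suc n) + F (suc a) * F n - s * F a * F n
  F-add zero          a = base s (F a) (F (suc a))
    where
    base : ∀ s x y → x ≡ x * + 1 + y * + 0 - s * x * + 0
    base = solve-∀
  F-add (suc zero)    a = base s (F a) (F (suc a))
    where
    base : ∀ s x y → y ≡ x * (s * + 1 + (- + 1) * + 0) + y * + 1 - s * x * + 1
    base = solve-∀
  F-add (suc (suc n)) a = begin
    F (suc (suc n) ℕ.+ a)                                              ≡⟨ F-rec (n ℕ.+ a) ⟩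
    s * F (suc n ℕ.+ a) - F (n ℕ.+ a)                                  ≡⟨ cong₂ (λ u v → s * u - v) (F-add (suc n) a) (F-add n a) ⟩
    s * (x * B + y * A - s * x * A) - (x * A + y * A₀ - s * x * A₀)    ≡⟨ cong (λ B → s * (x * B + y * A - s * x * A) - (x * A + y * A₀ - s * x * A₀)) (F-rec n) ⟩
    s * (x * (s * A - A₀) + y * A - s * x * A) - (x * A + y * A₀ - s * x * A₀)
                                                                       ≡⟨ lemma s x y A₀ A ⟩
    x * (s * (s * A - A₀) - A) + y * (s * A - A₀) - s * x * (s * A - A₀)
                                                                       ≡⟨ cong (λ B → x * (s * B - A) + y * B - s * x * B) (F-rec n) ⟨
    x * (s * B - A) + y * B - s * x * B                                ≡⟨ cong (λ C → x * C + y * B - s * x * B) (F-rec (suc n)) ⟨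
    x * F (suc (suc (suc n))) + y * B - s * x * B                      ∎
    where
    x = F a
    y = F (suc a)
    A₀ = F n
    A = F (suc n)
    B = F (suc (suc n))
    lemma : ∀ s x y A₀ A → s * (x * (s * A - A₀) + y * A - s * x * A) - (x * A + y * A₀ - s * x * A₀)
                           ≡ x * (s * (s * A - A₀) - A) + y * (s * A - A₀) - s * x * (s * A - A₀)
    lemma = solve-∀

  F-dOcagne : ∀ j t → F (suc j) * F (j ℕ.+ t) - F j * F (suc (j ℕ.+ t)) ≡ F t
  F-dOcagne zero    t = base (F t) (F (suc t))
    where
    base : ∀ x y → + 1 * x - + 0 * y ≡ x
    base = solve-∀
  F-dOcagne (suc j) t = begin
    F (suc (suc j)) * B - b * F (suc (suc (j ℕ.+ t)))  ≡⟨ cong₂ (λ c C → c * B - b * C) (F-rec j) (F-rec (j ℕ.+ t)) ⟩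
    (s * b - a) * B - b * (s * B - A)                  ≡⟨ lemma s b a B A ⟩
    b * A - a * B                                      ≡⟨ F-dOcagne j t ⟩
    F t                                                ∎
    where
    a = F j
    b = F (suc j)
    A = F (j ℕ.+ t)
    B = F (suc (j ℕ.+ t))
    lemma : ∀ s b a B A → (s * b - a) * B - b * (s * B - A) ≡ b * A - a * B
    lemma = solve-∀

  -- Difference of squares:  F(a+b) F(b-a) = F(b)² - F(a)²,  written with b = a + t.
  F-squares : ∀ a t → F (a ℕ.+ (a ℕ.+ t)) * F t ≡ F (a ℕ.+ t) * F (a ℕ.+ t) - F a * F a
  F-squares a t = begin
    F (a ℕ.+ (a ℕ.+ t)) * F t                                     ≡⟨ cong₂ _*_ (F-add a (a ℕ.+ t)) (sym (F-dOcagne a t)) ⟩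
    (X * y + Y * x - s * X * x) * (y * X - x * Y)                 ≡⟨ lemma s X Y x y ⟩
    X * X * (y * y - s * x * y + x * x) - x * x * (Y * Y - s * X * Y + X * X)
                                                                  ≡⟨ cong₂ (λ u v → X * X * u - x * x * v) (F-cassini a) (F-cassini (a ℕ.+ t)) ⟩
    X * X * + 1 - x * x * + 1                                     ≡⟨ unit X x ⟩
    X * X - x * x                                                 ∎
    where
    x = F a
    y = F (suc a)
    X = F (a ℕ.+ t)
    Y = F (suc (a ℕ.+ t))
    lemma : ∀ s X Y x y → (X * y + Y * x - s * X * x) * (y * X - x * Y)
                          ≡ X * X * (y * y - s * x * y + x * x) - x * x * (Y * Y - s * X * Y + X * X)
    lemma = solve-∀
    unit : ∀ X x → X * X * + 1 - x * x * + 1 ≡ X * X - x * x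
    unit = solve-∀

module Divisibility (s : ℤ) where

  open import Data.Nat using (_*_; _%_; _/_)
  open import Data.Nat.DivMod using (m≡m%n+[m/n]*n; m%n<n)
  open import Data.Integer using (_+_; _-_) renaming (_*_ to _·_)
  open import Data.Integer.Divisibility.Signed using (_∣_; ∣m⇒∣m*n; ∣n⇒∣m*n; ∣m∣n⇒∣m+n; ∣m∣n⇒∣m-n)
  open Identities s

  ∣-add : ∀ {D} n a → D ∣ F a → D ∣ F n → D ∣ F (n ℕ.+ a)
  ∣-add n a D∣Fa D∣Fn = subst (_ ∣_) (sym (F-add n a))
    (∣m∣n⇒∣m-n (∣m∣n⇒∣m+n (∣m⇒∣m*n _ D∣Fa) (∣n⇒∣m*n (F (suc a)) D∣Fn)) (∣n⇒∣m*n (s · F a) D∣Fn))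

  ∣-sub : ∀ {D} n a → D ∣ F (n ℕ.+ a) → D ∣ F a → D ∣ F (suc a) · F n
  ∣-sub n a D∣Fn+a D∣Fa = subst (_ ∣_) (isolate {C = F (suc a)} (F-add n a))
    (∣m∣n⇒∣m+n (∣m∣n⇒∣m-n D∣Fn+a (∣m⇒∣m*n _ D∣Fa)) (∣m⇒∣m*n (F n) (∣n⇒∣m*n s D∣Fa)))
    where
    isolate : ∀ {N A B C E} → N ≡ A · B + C · E - s · A · E → N - A · B + s · A · E ≡ C · E
    isolate {A = A} {B} {C} {E} refl = lemma s A B C E
      where
      lemma : ∀ s A B C E → A · B + C · E - s · A · E - A · B + s · A · E ≡ C · E
      lemma = solve-∀

  ∣-multiple : ∀ {D} m → D ∣ F m → ∀ q → D ∣ F (q * m)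
  ∣-multiple m D∣Fm zero    = ℤS.divides (+ 0) refl
  ∣-multiple m D∣Fm (suc q) = ∣-add m (q * m) (∣-multiple m D∣Fm q) D∣Fm

  module _ {p : ℕ} (pp : Prime p) where
    open PrimeDivisibility pp using (euclid; ∤1)

    -- Consecutive terms are coprime to p, by Cassini's identity.
    coprime : ∀ n → + p ∣ F n → ¬ + p ∣ F (suc n)
    coprime n p∣x p∣y = ∤1 (subst (_ ∣_) (F-cassini n)
      (∣m∣n⇒∣m+n (∣m∣n⇒∣m-n (∣m⇒∣m*n _ p∣y) (∣n⇒∣m*n (s · F n) p∣y)) (∣m⇒∣m*n _ p∣x)))

    -- d = d₀ + 1 is the rank of apparition of p: the least positive index with p ∣ F(d).
    record IsRank (d₀ : ℕ) : Set where
      field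
        apparent : + p ∣ F (suc d₀)
        minimal  : ∀ {r} → r ℕ.< d₀ → ¬ + p ∣ F (suc r)

    -- p ∣ F(n) forces d ∣ n: writing n = r + q d with 0 < r < d,
    -- p would divide F(q d + 1) F(r), hence F(r), against minimality.
    rank-∣ : ∀ {d₀} → IsRank d₀ → ∀ n → + p ∣ F n → suc d₀ ℕD.∣ n
    rank-∣ {d₀} isRank n p∣Fn with n % suc d₀ | m%n<n n (suc d₀) | m≡m%n+[m/n]*n n (suc d₀)
    ... | zero  | _        | n≡qd   = divides (n / suc d₀) n≡qd
    ... | suc r | s≤s r<d₀ | n≡r+qd =
      ⊥-elim (impossible (euclid (F (suc qd)) (F (suc r)) (∣-sub (suc r) qd p∣Fr+qd p∣Fqd)))
      where
      qd = n / suc d₀ * suc d₀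
      p∣Fqd : + p ∣ F qd
      open IsRank isRank
      p∣Fqd = ∣-multiple (suc d₀) apparent (n / suc d₀)
      p∣Fr+qd : + p ∣ F (suc r ℕ.+ qd)
      p∣Fr+qd = subst (λ m → + p ∣ F m) n≡r+qd p∣Fn
      impossible : (+ p ∣ F (suc qd)) ⊎ (+ p ∣ F (suc r)) → ⊥
      impossible (inj₁ p∣Fqd+1) = coprime qd p∣Fqd p∣Fqd+1
      impossible (inj₂ p∣Fr)    = minimal r<d₀ p∣Fr

-- An
-- induction on k expands F(km) to second order in x; from the expansion,
-- ν_p(F(km)) = ν_p(F(m)) + ν_p(k) whenever p ∣ F(m) and ν_p(k) ≤ 1.
module Lifting (s : ℤ) (m : ℕ) where

  open import Data.Nat using (_*_)
  open import Data.Integer using (_+_; _-_; _^_) renaming (_*_ to _·_)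
  open Identities s
  open ≡-Reasoning

  x y : ℤ
  x = F m
  y = F (suc m)

  u w : ℕ → ℤ
  u k = F (k * m)
  w k = F (suc (k * m))

  u-suc : ∀ k → u (suc k) ≡ u k · y + w k · x - s · u k · x
  u-suc k = F-add m (k * m)

  w-suc : ∀ k → w (suc k) ≡ w k · y - u k · x
  w-suc k = begin
    F (suc (m ℕ.+ k * m))                             ≡⟨ cong F (ℕP.+-suc m (k * m)) ⟨
    F (m ℕ.+ suc (k * m))                             ≡⟨ F-add m (suc (k * m)) ⟩
    w k · y + F (suc (suc (k * m))) · x - s · w k · x ≡⟨ cong (λ z → w k · y + z · x - s · w k · x) (F-rec (k * m)) ⟩
    w k · y + (s · w k - u k) · x - s · w k · x       ≡⟨ lemma s x y (u k) (w k) ⟩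
    w k · y - u k · x                                 ∎
    where
    lemma : ∀ s x y u w → w · y + (s · w - u) · x - s · w · x ≡ w · y - u · x
    lemma = solve-∀

  -- The second-order coefficient:  2 y² F(km) = x · J(k, X)  with
  -- J(k, X) = k · A(k) + x² X  and  A(k) = 2 y^(k+1) - (k-1) s y^k x.
  A : ℕ → ℤ
  A k = + 2 · y ^ suc k - (+ k - + 1) · s · y ^ k · x

  J : ℕ → ℤ → ℤ
  J k X = + k · A k + x · x · X

  expansion : ∀ k → ∃[ Z ] ∃[ Y ] ∃[ X ]
    (u k ≡ x · Z × w k ≡ y ^ k + x · x · Y × + 2 · y · y · u k ≡ x · J k X)
  expansion zero = + 0 , + 0 , + 0 , base₁ x , base₂ x , base₃ s x y
    where
    base₁ : ∀ x → + 0 ≡ x · + 0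
    base₁ = solve-∀
    base₂ : ∀ x → + 1 ≡ + 1 + x · x · + 0
    base₂ = solve-∀
    base₃ : ∀ s x y → + 2 · y · y · + 0 ≡ x · (+ 0 · (+ 2 · (y · + 1) - (+ 0 - + 1) · s · + 1 · x) + x · x · + 0)
    base₃ = solve-∀
  expansion (suc k) with expansion k
  ... | Z , Y , X , uₖ≡ , wₖ≡ , 2y²uₖ≡ =
      Z · (y - s · x) + w k ,
      Y · y - Z ,
      X · (y - s · x) + + k · (+ k - + 1) · s · s · y ^ k + + 2 · y · y · Y ,
      trans (u-suc k) (step-u uₖ≡) ,
      trans (w-suc k) (step-w wₖ≡ uₖ≡) ,
      trans (cong (+ 2 · y · y ·_) (u-suc k)) (step-J wₖ≡ 2y²uₖ≡)
    where
    step-u : ∀ {U} → U ≡ x · Z → U · y + w k · x - s · U · x ≡ x · (Z · (y - s · x) + w k)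
    step-u refl = lemma x y s (w k) Z
      where
      lemma : ∀ x y s w Z → x · Z · y + w · x - s · (x · Z) · x ≡ x · (Z · (y - s · x) + w)
      lemma = solve-∀
    step-w : ∀ {W U} → W ≡ y ^ k + x · x · Y → U ≡ x · Z → W · y - U · x ≡ y ^ suc k + x · x · (Y · y - Z)
    step-w refl refl = lemma x y (y ^ k) Y Z
      where
      lemma : ∀ x y yᵏ Y Z → (yᵏ + x · x · Y) · y - x · Z · x ≡ y · yᵏ + x · x · (Y · y - Z)
      lemma = solve-∀
    step-J : ∀ {W} → W ≡ y ^ k + x · x · Y → + 2 · y · y · u k ≡ x · J k X →
             + 2 · y · y · (u k · y + W · x - s · u k · x)
             ≡ x · J (suc k) (X · (y - s · x) + + k · (+ k - + 1) · s · s · y ^ k + + 2 · y · y · Y)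
    step-J refl e = begin
      + 2 · y · y · (u k · y + W · x - s · u k · x)   ≡⟨ regroup x y s (u k) W ⟩
      + 2 · y · y · u k · (y - s · x) + + 2 · y · y · W · x
                                                    ≡⟨ cong (λ z → z · (y - s · x) + + 2 · y · y · W · x) e ⟩
      x · J k X · (y - s · x) + + 2 · y · y · W · x  ≡⟨ lemma x y s (y ^ k) X Y (+ k) ⟩
      x · J (suc k) (X · (y - s · x) + + k · (+ k - + 1) · s · s · y ^ k + + 2 · y · y · Y) ∎
      where
      W = y ^ k + x · x · Y
      regroup : ∀ x y s U W → + 2 · y · y · (U · y + W · x - s · U · x) ≡ + 2 · y · y · U · (y - s · x) + + 2 · y · y · W · x
      regroup = solve-∀
      lemma : ∀ x y s yᵏ X Y K →
        x · (K · (+ 2 · (y · yᵏ) - (K - + 1) · s · yᵏ · x) + x · x · X) · (y - s · x) + + 2 · y · y · (yᵏ + x · x · Y) · x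
        ≡ x · ((+ 1 + K) · (+ 2 · (y · (y · yᵏ)) - ((+ 1 + K) - + 1) · s · (y · yᵏ) · x)
               + x · x · (X · (y - s · x) + K · (K - + 1) · s · s · yᵏ + + 2 · y · y · Y))
      lemma = solve-∀

  module _ {p : ℕ} (pp : Prime p) (3≤p : 3 ≤ p) where
    open import Data.Integer.Divisibility.Signed using (_∣_; ∣n⇒∣m*n; ∣m∣n⇒∣m+n)
    open Valuation
    open PrimeDivisibility pp using (∤2; ∤^; ∤*)
    private instance
      p≢0 : NonZero p
      p≢0 = prime⇒nonZero pp

    square-∣ : ∀ z → + p ∣ x → p ℕ.^ 2 ℕD.∣ ∣ x · x · z ∣
    square-∣ z p∣x = subst₂ ℕD._∣_ (cong (p *_) (sym (ℕP.*-identityʳ p))) (sym |x·x·z|)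
      (ℕD.∣m⇒∣m*n ∣ z ∣ (ℕD.*-pres-∣ (fromSigned {x = x} p∣x) (fromSigned {x = x} p∣x)))
      where
      |x·x·z| : ∣ x · x · z ∣ ≡ ∣ x ∣ * ∣ x ∣ * ∣ z ∣
      |x·x·z| = trans (ℤP.abs-* (x · x) z) (cong (_* ∣ z ∣) (ℤP.abs-* x x))

    -- In 2y² F(km) = x · J(k, X) the factor 2y² is prime to p (p is odd and
    -- coprime to y), while ν_p(J(k, X)) = ν_p(k A(k)) = e because p ∤ A(k)
    -- and p^(e+1) ∣ p² ∣ x² X.
    lifting : ∀ {a e} k → + p ∣ x → IsVal p x a → IsVal p (+ k) e → e ≤ 1 → u k ≢ + 0 →
              IsVal p (u k) (a ℕ.+ e)
    lifting {a} {e} k p∣x νx νk e≤1 uₖ≢0 with expansion k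
    ... | _ , _ , X , _ , _ , 2y²uₖ≡ = val-transfer pp {+ 2 · y · y} {u k} {x} {J k X} {a} {e} ν[2y²] 2y²uₖ≡ νx νJ uₖ≢0
      where
      p∤y : ¬ + p ∣ y
      p∤y = Divisibility.coprime s pp m p∣x
      ν[2y²] : IsVal p (+ 2 · y · y) 0
      ν[2y²] = val-unit {x = + 2 · y · y} λ p∣2y² →
        ∤* (∤* (∤2 3≤p) p∤y) p∤y (toSigned {x = + 2 · y · y} p∣2y²)
      A≡ : A k + (+ k - + 1) · s · y ^ k · x ≡ + 2 · y ^ suc k
      A≡ = cancel (+ 2 · y ^ suc k) ((+ k - + 1) · s · y ^ k · x)
        where
        cancel : ∀ a b → a - b + b ≡ a
        cancel = solve-∀
      p∤A : ¬ + p ∣ A k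
      p∤A p∣A = ∤* (∤2 3≤p) (∤^ p∤y (suc k)) (subst (+ p ∣_) A≡ (∣m∣n⇒∣m+n p∣A (∣n⇒∣m*n ((+ k - + 1) · s · y ^ k) p∣x)))
      νkA : IsVal p (+ k · A k) e
      νkA = subst (IsVal p (+ k · A k)) (ℕP.+-identityʳ e)
        (val-* pp {+ k} {A k} {e} {0} νk (val-unit {x = A k} λ p∣A → p∤A (toSigned {x = A k} p∣A)))
      νJ : IsVal p (J k X) e
      νJ = val-+ {p} {+ k · A k} {x · x · X} {e} νkA (ℕD.∣-trans (pow-∣ p (s≤s e≤1)) (square-∣ X p∣x))

module Positivity (k : ℕ) where

  open import Data.Nat using (_+_; _*_; _∸_)
  open Identities (+ (2 + k))

  increasing : ∀ n → ∃[ a ] ∃[ b ] (F n ≡ + a × F (suc n) ≡ + b × a < b)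
  increasing zero = 0 , 1 , refl , refl , s≤s z≤n
  increasing (suc n) with increasing n
  ... | a , b , Fn≡a , Fn+1≡b , a<b = b , (2 + k) * b ∸ a , Fn+1≡b , Fn+2≡ , b<c
    where
    a≤[1+k]b : a ≤ (1 + k) * b
    a≤[1+k]b = ℕP.≤-trans (ℕP.<⇒≤ a<b) (ℕP.m≤m+n b (k * b))
    Fn+2≡ : F (suc (suc n)) ≡ + ((2 + k) * b ∸ a)
    Fn+2≡ = begin
      F (suc (suc n))                ≡⟨ F-rec n ⟩
      + (2 + k) ℤ.* F (suc n) ℤ.- F n ≡⟨ cong₂ (λ u v → + (2 + k) ℤ.* u ℤ.- v) Fn+1≡b Fn≡a ⟩
      + (2 + k) ℤ.* + b ℤ.- + a      ≡⟨ cong (ℤ._- + a) (ℤP.pos-* (2 + k) b) ⟨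
      + ((2 + k) * b) ℤ.- + a        ≡⟨ ℤP.m-n≡m⊖n _ a ⟩
      (2 + k) * b ℤ.⊖ a              ≡⟨ ℤP.⊖-≥ (ℕP.≤-trans a≤[1+k]b (ℕP.m≤n+m _ b)) ⟩
      + ((2 + k) * b ∸ a)            ∎
      where open ≡-Reasoning
    b<c : b < (2 + k) * b ∸ a
    b<c = subst (b <_) (sym (ℕP.+-∸-assoc b a≤[1+k]b))
            (ℕP.m<m+n b (ℕP.m<n⇒0<n∸m (ℕP.<-≤-trans a<b (ℕP.m≤m+n b (k * b)))))

  F-natural : ∀ n → F n ≡ + ∣ F n ∣
  F-natural n with increasing n
  ... | a , _ , Fn≡a , _ = trans Fn≡a (cong (λ z → + ∣ z ∣) (sym Fn≡a))

  F-nonzero : ∀ {n} → 1 ≤ n → F n ≢ + 0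
  F-nonzero {suc n} _ Fn+1≡0 with increasing n
  ... | _ , suc _ , _ , Fn+1≡b , _ with () ← trans (sym Fn+1≡b) Fn+1≡0

-- Folding the nonzero residues modulo an odd number 2h + 1 onto {0, …, h - 1}
-- so that r and 2h + 1 - r are identified: r ↦ r - 1 for r ≤ h, r ↦ 2h - r otherwise.
module Folding (h : ℕ) where

  open import Data.Nat using (_+_; _∸_; _≤?_)
  open ℕP using (≤-trans; ≤-reflexive; m+[n∸m]≡n; m∸n+n≡m; m<n⇒0<n∸m; <⇒≤; ≰⇒>)

  odd : ℕ
  odd = suc (h + h)

  fold : ℕ → ℕ
  fold r with r ≤? h
  ... | yes _ = r ∸ 1
  ... | no  _ = odd ∸ r ∸ 1

  fold< : ∀ r → 1 ≤ r → r < odd → fold r < h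
  fold< r 1≤r r<odd with r ≤? h
  ... | yes r≤h = ≤-trans (≤-reflexive (m+[n∸m]≡n 1≤r)) r≤h
  ... | no  r≰h = ≤-trans (≤-reflexive (m+[n∸m]≡n (m<n⇒0<n∸m r<odd))) odd∸r≤h
    where
    odd∸r≤h : odd ∸ r ≤ h
    odd∸r≤h = ≤-trans (ℕP.∸-monoʳ-≤ odd (≰⇒> r≰h)) (≤-reflexive (ℕP.m+n∸m≡n h h))

  unfold : ∀ {a b} → 1 ≤ a → 1 ≤ b → a ∸ 1 ≡ b ∸ 1 → a ≡ b
  unfold 1≤a 1≤b eq = trans (sym (m∸n+n≡m 1≤a)) (trans (cong (_+ 1) eq) (m∸n+n≡m 1≤b))

  fold-injective : ∀ r r′ → 1 ≤ r → r < odd → 1 ≤ r′ → r′ < odd → fold r ≡ fold r′ →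
                   r ≡ r′ ⊎ r + r′ ≡ odd
  fold-injective r r′ 1≤r r<odd 1≤r′ r′<odd eq with r ≤? h | r′ ≤? h
  ... | yes _ | yes _ = inj₁ (unfold 1≤r 1≤r′ eq)
  ... | no  _ | no  _ = inj₁ (ℕP.∸-cancelˡ-≡ (<⇒≤ r<odd) (<⇒≤ r′<odd)
                              (unfold (m<n⇒0<n∸m r<odd) (m<n⇒0<n∸m r′<odd) eq))
  ... | yes _ | no  _ = inj₂ (trans (cong (_+ r′) (unfold 1≤r (m<n⇒0<n∸m r′<odd) eq)) (m∸n+n≡m (<⇒≤ r′<odd)))
  ... | no  _ | yes _ = inj₂ (trans (ℕP.+-comm r r′)
                             (trans (cong (_+ r) (unfold 1≤r′ (m<n⇒0<n∸m r<odd) (sym eq))) (m∸n+n≡m (<⇒≤ r<odd))))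

module Residues (p : ℕ) .{{_ : NonZero p}} where

  open import Data.Nat.DivMod using (_%_; _/_; m≡m%n+[m/n]*n)
  open import Data.Integer using (_+_; _-_; _*_)
  open import Data.Integer.Divisibility.Signed using (_∣_; divides)
  open ≡-Reasoning

  decompose : ∀ A → + A ≡ + (A % p) + + (A / p) * + p
  decompose A = begin
    + A                                 ≡⟨ cong +_ (m≡m%n+[m/n]*n A p) ⟩
    + (A % p ℕ.+ A / p ℕ.* p)           ≡⟨ ℤP.pos-+ (A % p) _ ⟩
    + (A % p) + + (A / p ℕ.* p)         ≡⟨ cong (λ z → + (A % p) + z) (ℤP.pos-* (A / p) p) ⟩
    + (A % p) + + (A / p) * + p         ∎

  same-residue : ∀ A B → A % p ≡ B % p → + p ∣ + B - + A
  same-residue A B eq = divides (+ (B / p) - + (A / p)) (begin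
    + B - + A                                                       ≡⟨ cong₂ _-_ (decompose B) (decompose A) ⟩
    (+ (B % p) + + (B / p) * + p) - (+ (A % p) + + (A / p) * + p)  ≡⟨ cong (λ r → (+ (B % p) + + (B / p) * + p) - (+ r + + (A / p) * + p)) eq ⟩
    (+ (B % p) + + (B / p) * + p) - (+ (B % p) + + (A / p) * + p)  ≡⟨ lemma (+ (B % p)) (+ (B / p)) (+ (A / p)) (+ p) ⟩
    (+ (B / p) - + (A / p)) * + p                                   ∎)
    where
    lemma : ∀ r b a P → (r + b * P) - (r + a * P) ≡ (b - a) * P
    lemma = solve-∀

  opposite-residue : ∀ A B → A % p ℕ.+ B % p ≡ p → + p ∣ + B + + A
  opposite-residue A B eq = divides (+ 1 + + (B / p) + + (A / p)) (begin
    + B + + A                                                       ≡⟨ cong₂ _+_ (decompose B) (decompose A) ⟩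
    (+ (B % p) + + (B / p) * + p) + (+ (A % p) + + (A / p) * + p)  ≡⟨ lemma (+ (B % p)) (+ (A % p)) (+ (B / p)) (+ (A / p)) (+ p) ⟩
    (+ (A % p) + + (B % p)) + (+ (B / p) + + (A / p)) * + p         ≡⟨ cong (λ z → z + (+ (B / p) + + (A / p)) * + p) (trans (sym (ℤP.pos-+ (A % p) (B % p))) (cong +_ eq)) ⟩
    + p + (+ (B / p) + + (A / p)) * + p                             ≡⟨ lemma′ (+ p) (+ (B / p)) (+ (A / p)) ⟩
    (+ 1 + + (B / p) + + (A / p)) * + p                             ∎)
    where
    lemma : ∀ rb ra b a P → (rb + b * P) + (ra + a * P) ≡ (ra + rb) + (b + a) * P
    lemma = solve-∀
    lemma′ : ∀ P b a → P + (b + a) * P ≡ (+ 1 + b + a) * P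
    lemma′ = solve-∀

least : ∀ {Q : ℕ → Set} → (∀ n → Dec (Q n)) → ∀ {n} → Q n →
        ∃[ m ] (m ≤ n × Q m × (∀ {j} → j < m → ¬ Q j))
least {Q} Q? = <-rec _ search _
  where
  search : ∀ n → (∀ {j} → j < n → Q j → ∃[ m ] (m ≤ j × Q m × (∀ {i} → i < m → ¬ Q i))) →
           Q n → ∃[ m ] (m ≤ n × Q m × (∀ {i} → i < m → ¬ Q i))
  search n smaller Qn with ℕP.anyUpTo? Q? n
  ... | no  none = n , ℕP.≤-refl , Qn , λ j<n Qj → none (_ , j<n , Qj)
  ... | yes (j , j<n , Qj) with m , m≤j , Qm , minimal ← smaller j<n Qj =
        m , ℕP.≤-trans m≤j (ℕP.<⇒≤ j<n) , Qm , minimal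

-- For s = 2 + k and an odd prime p, some F(n) with
-- 1 ≤ n ≤ p is divisible by p: either one of F(1), …, F(h + 1) is (p = 2h + 1),
-- or two of them have equal or opposite residues, and then p divides
-- F(b)² - F(a)² = F(a + b) F(b - a).
module Apparition (k : ℕ) {p : ℕ} (pp : Prime p) (3≤p : 3 ≤ p) where

  open import Data.Nat using (_+_; _∸_)
  open import Data.Nat.DivMod using (_%_; _/_; m≡m%n+[m/n]*n; m%n<n)
  open import Data.Nat.Primality using (prime⇒irreducible)
  open import Data.Integer.Divisibility.Signed using (_∣_; _∣?_; ∣m⇒∣m*n; ∣n⇒∣m*n)
  open import Data.Fin using (Fin; toℕ; fromℕ<)
  import Data.Fin.Properties as FinP
  open Identities (+ (2 + k))
  open Positivity k using (F-natural)
  open PrimeDivisibility pp using (euclid)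
  open Valuation using (toSigned)
  open ℕP using (≤-trans; m≤m+n; n≤1+n)

  private instance
    p≢0 : NonZero p
    p≢0 = prime⇒nonZero pp

  p-odd : ∃[ h ] p ≡ suc (h + h)
  p-odd with p % 2 | m%n<n p 2 | m≡m%n+[m/n]*n p 2
  ... | 0 | _ | p≡2q with prime⇒irreducible pp (divides (p / 2) p≡2q)
  ...   | inj₁ ()
  ...   | inj₂ 2≡p = ⊥-elim (ℕP.<-irrefl 2≡p 3≤p)
  p-odd | 1 | _ | p≡2q+1 = p / 2 , trans p≡2q+1 (cong suc (trans (ℕP.*-comm (p / 2) 2) (cong (λ z → p / 2 + z) (ℕP.+-identityʳ (p / 2)))))
  p-odd | suc (suc _) | s≤s (s≤s ()) | _

  Apparent : Set
  Apparent = ∃[ n ] (1 ≤ n × n ≤ p × + p ∣ F n)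

  squares-∣ : ∀ {D} X Y → (D ∣ Y ℤ.- X) ⊎ (D ∣ Y ℤ.+ X) → D ∣ Y ℤ.* Y ℤ.- X ℤ.* X
  squares-∣ X Y D∣Y∓X = subst (_ ∣_) (factor X Y) (case D∣Y∓X)
    where
    factor : ∀ X Y → (Y ℤ.- X) ℤ.* (Y ℤ.+ X) ≡ Y ℤ.* Y ℤ.- X ℤ.* X
    factor = solve-∀
    case : _ → _ ∣ (Y ℤ.- X) ℤ.* (Y ℤ.+ X)
    case (inj₁ D∣Y-X) = ∣m⇒∣m*n (Y ℤ.+ X) D∣Y-X
    case (inj₂ D∣Y+X) = ∣n⇒∣m*n (Y ℤ.- X) D∣Y+X

  from-squares : ∀ {h} → p ≡ suc (h + h) → ∀ a b → a < b → b ≤ suc h →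
                 + p ∣ F b ℤ.* F b ℤ.- F a ℤ.* F a → Apparent
  from-squares {h} p≡ a b a<b b≤h+1 p∣F²-F²
    with euclid (F (a + b)) (F (b ∸ a)) (subst (+ p ∣_) (sym squares) p∣F²-F²)
    where
    squares : F (a + b) ℤ.* F (b ∸ a) ≡ F b ℤ.* F b ℤ.- F a ℤ.* F a
    squares with t , refl ← ℕP.m≤n⇒∃[o]m+o≡n (ℕP.<⇒≤ a<b) rewrite ℕP.m+n∸m≡n a t = F-squares a t
  ... | inj₁ p∣Fa+b = a + b , ≤-trans (ℕP.<-≤-trans (s≤s z≤n) a<b) (ℕP.m≤n+m b a) , a+b≤p , p∣Fa+b
    where
    a+b≤p : a + b ≤ p
    a+b≤p = subst (a + b ≤_) (sym p≡)
      (subst (a + b ≤_) (ℕP.+-suc h h) (ℕP.+-mono-≤ (ℕP.≤-pred (ℕP.<-≤-trans a<b b≤h+1)) b≤h+1))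
  ... | inj₂ p∣Fb-a = b ∸ a , ℕP.m<n⇒0<n∸m a<b , b-a≤p , p∣Fb-a
    where
    b-a≤p : b ∸ a ≤ p
    b-a≤p = ≤-trans (ℕP.m∸n≤m b a) (≤-trans b≤h+1 (subst (suc h ≤_) (sym p≡) (s≤s (m≤m+n h h))))

  apparition : Apparent
  apparition with h , p≡ ← p-odd with ℕP.anyUpTo? (λ i → + p ∣? F (suc i)) (suc h)
  ... | yes (i , i<h+1 , p∣Fi+1) =
        suc i , s≤s z≤n , ≤-trans i<h+1 (subst (suc h ≤_) (sym p≡) (s≤s (m≤m+n h h))) , p∣Fi+1
  ... | no  none = collision (FinP.pigeonhole (ℕP.n<1+n h) folded)
    where
    open Folding h using (odd; fold; fold<; fold-injective)
    open Residues p using (same-residue; opposite-residue)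

    residue : ℕ → ℕ
    residue i = ∣ F (suc i) ∣ % p

    residue≥1 : ∀ i → i < suc h → 1 ≤ residue i
    residue≥1 i i<h+1 with residue i in r≡0
    ... | suc _ = s≤s z≤n
    ... | zero  = ⊥-elim (none (i , i<h+1 , toSigned {x = F (suc i)} (ℕD.m%n≡0⇒n∣m _ p r≡0)))

    residue<odd : ∀ i → residue i < odd
    residue<odd i = subst (residue i <_) p≡ (m%n<n _ p)

    folded : Fin (suc h) → Fin h
    folded i = fromℕ< (fold< (residue (toℕ i)) (residue≥1 (toℕ i) (FinP.toℕ<n i)) (residue<odd (toℕ i)))

    residues-∣ : ∀ i j → residue i ≡ residue j ⊎ residue i + residue j ≡ odd →
                 + p ∣ F (suc j) ℤ.* F (suc j) ℤ.- F (suc i) ℤ.* F (suc i)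
    residues-∣ i j r≡ = squares-∣ (F (suc i)) (F (suc j)) (case r≡)
      where
      natural : ∀ {R : ℤ → ℤ → Set} → R (+ ∣ F (suc j) ∣) (+ ∣ F (suc i) ∣) → R (F (suc j)) (F (suc i))
      natural {R} = subst₂ R (sym (F-natural (suc j))) (sym (F-natural (suc i)))
      case : _ → (+ p ∣ F (suc j) ℤ.- F (suc i)) ⊎ (+ p ∣ F (suc j) ℤ.+ F (suc i))
      case (inj₁ same)     = inj₁ (natural {λ Y X → + p ∣ Y ℤ.- X} (same-residue _ _ same))
      case (inj₂ opposite) = inj₂ (natural {λ Y X → + p ∣ Y ℤ.+ X} (opposite-residue _ _ (trans opposite (sym p≡))))

    collision : ∃[ i ] ∃[ j ] (i Data.Fin.< j × folded i ≡ folded j) → Apparent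
    collision (i , j , i<j , same-fold) =
      from-squares p≡ (suc (toℕ i)) (suc (toℕ j)) (s≤s i<j) (FinP.toℕ<n j)
        (residues-∣ (toℕ i) (toℕ j)
          (fold-injective _ _ (residue≥1 (toℕ i) (FinP.toℕ<n i)) (residue<odd (toℕ i))
                              (residue≥1 (toℕ j) (FinP.toℕ<n j)) (residue<odd (toℕ j))
                              (trans (sym (FinP.toℕ-fromℕ< _)) (trans (cong toℕ same-fold) (FinP.toℕ-fromℕ< _)))))

δ-on : ∀ {d n} → d ℕD.∣ n → δ d n ≡ 1
δ-on {d} {n} d∣n rewrite dec-true (d ℕD.∣? n) d∣n = refl

δ-off : ∀ {d n} → ¬ d ℕD.∣ n → δ d n ≡ 0
δ-off {d} {n} d∤n rewrite dec-false (d ℕD.∣? n) d∤n = refl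

module Valuations (k : ℕ) {p : ℕ} (pp : Prime p) (3≤p : 3 ≤ p) where

  open import Data.Nat using (_+_; _*_)
  open import Data.Integer.Divisibility.Signed using (_∣_; _∣?_)
  open Identities (+ (2 + k))
  open Positivity k using (F-nonzero)
  open Divisibility (+ (2 + k)) using (∣-multiple; IsRank; rank-∣)
  open Valuation
  private instance
    p≢0 : NonZero p
    p≢0 = prime⇒nonZero pp

  rank : ∃[ d₀ ] (IsRank pp d₀ × suc d₀ ≤ p)
  rank with suc n₀ , _ , n≤p , p∣Fn ← Apparition.apparition k pp 3≤p
       with d₀ , d₀≤n₀ , p∣Fd , minimal ← least (λ i → + p ∣? F (suc i)) p∣Fn =
    d₀ , record { apparent = p∣Fd ; minimal = minimal } , ℕP.≤-trans (s≤s d₀≤n₀) n≤p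

  -- Lifting the exponent along multiples:  ν_p(F(q m)) = ν_p(F(m)) + ν_p(q)  when p ∣ F(m).
  -- Induction on ν_p(q): the case p ∤ q and each further factor p are both instances of `lifting`.
  lte : ∀ m {a} → 1 ≤ m → + p ∣ F m → IsVal p (F m) a →
        ∀ e q → IsVal p (+ q) e → IsVal p (F (q * m)) (a + e)
  lte m {a} 1≤m p∣Fm νFm zero q νq =
    Lifting.lifting (+ (2 + k)) m pp 3≤p {a} q p∣Fm νFm νq z≤n (F-nonzero (ℕP.*-mono-≤ (val-positive {p} {q} {0} νq) 1≤m))
  lte m {a} 1≤m p∣Fm νFm (suc e) q νq with q′ , refl , νq′ ← val-peel pp {q} {e} νq =
    subst₂ (λ i v → IsVal p (F i) v) (reassociate p q′ m) (exponent a e)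
      (Lifting.lifting (+ (2 + k)) (q′ * m) pp 3≤p {a + e} p
        (∣-multiple m p∣Fm q′) (lte m {a} 1≤m p∣Fm νFm e q′ νq′) (val-prime pp) (s≤s z≤n)
        (F-nonzero (ℕP.*-mono-≤ (val-positive {p} {p} {1} (val-prime pp)) (ℕP.*-mono-≤ (val-positive {p} {q′} {e} νq′) 1≤m))))
    where
    reassociate : ∀ p q m → p * (q * m) ≡ q * p * m
    reassociate = ℕRing.solve-∀
    exponent : ∀ a e → a + e + 1 ≡ a + suc e
    exponent = ℕRing.solve-∀

  module _ {d₀ : ℕ} (isRank : IsRank pp d₀) where
    open IsRank isRank using (apparent)
    open import Data.Integer using (_-_)

    d : ℕ
    d = suc d₀

    νF[d] : ∃[ a ] IsVal p (F d) a
    νF[d] = val-exists pp (F d) (F-nonzero {d} (s≤s z≤n))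

    νd : ∃[ j ] IsVal p (+ d) j
    νd = val-existsℕ pp d (λ ())

    νQ : ∀ {n c} → IsVal p (+ n) c → IsValQ p (F d ℤ.* + n) (+ d) (+ (proj₁ νF[d] + c) - + proj₁ νd)
    νQ {n} {c} νn = proj₁ νF[d] + c , proj₁ νd ,
                    val-* pp {F d} {+ n} {proj₁ νF[d]} {c} (proj₂ νF[d]) νn , proj₂ νd , refl

    formula : ∀ n → 1 ≤ n → ∃[ v ] ∃[ w ]
              (IsVal p (F n) v × IsValQ p (F d ℤ.* + n) (+ d) w × + v ≡ + δ d n ℤ.* w)
    formula n 1≤n with d ℕD.∣? n
    ... | no d∤n with c , νn ← val-existsℕ pp n (ℕP.n>0⇒n≢0 1≤n) =
      0 , w , val-unit {x = F n} p∤Fn , νQ νn , trans (sym (ℤP.*-zeroˡ w)) (cong (λ z → + z ℤ.* w) (sym (δ-off {d} {n} d∤n)))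
      where
      w = + (proj₁ νF[d] + c) - + proj₁ νd
      p∤Fn : ¬ p ℕD.∣ ∣ F n ∣
      p∤Fn p∣Fn = d∤n (rank-∣ pp isRank n (toSigned {x = F n} p∣Fn))
    ... | yes (divides q refl) with e , νq ← val-existsℕ pp q (λ { refl → ℕP.<-irrefl refl 1≤n }) =
      a + e , w , lte d {a} (s≤s z≤n) apparent (proj₂ νF[d]) e q νq ,
      νQ (val-*ℕ pp {q} {d} {e} {j} νq (proj₂ νd)) ,
      trans (cancel a e j) (trans (sym (ℤP.*-identityˡ w)) (cong (λ z → + z ℤ.* w) (sym (δ-on {d} (divides q refl)))))
      where
      a = proj₁ νF[d]
      j = proj₁ νd
      w = + (a + (e + j)) - + j
      cancel : ∀ a e j → + (a + e) ≡ + (a + (e + j)) - + j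
      cancel a e j = begin
        + (a + e)                    ≡⟨ ℤP.pos-+ a e ⟩
        + a ℤ.+ + e                  ≡⟨ lemma (+ a) (+ e) (+ j) ⟩
        + a ℤ.+ (+ e ℤ.+ + j) - + j  ≡⟨ cong (λ z → + a ℤ.+ z - + j) (ℤP.pos-+ e j) ⟨
        + a ℤ.+ + (e + j) - + j      ≡⟨ cong (_- + j) (ℤP.pos-+ a (e + j)) ⟨
        + (a + (e + j)) - + j        ∎
        where
        open ≡-Reasoning
        lemma : ∀ A E J → A ℤ.+ E ≡ A ℤ.+ (E ℤ.+ J) - J
        lemma = solve-∀

theorem12 : (s : ℤ) → (p : ℕ) → + 2 ℤ.≤ s → Prime p → p ≥ 3 →
    ∃[ s′ ] ∃[ d′ ] (1 ≤ d′ × d′ ≤ p ×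
      ((n : ℕ) → 1 ≤ n →
        ∃[ v ] ∃[ w ] (IsVal p (fib s (- + 1) n) v × IsValQ p (s′ ℤ.* + n) (+ d′) w
          × + v ≡ + δ d′ n ℤ.* w)))
theorem12 .(+ (2 ℕ.+ k)) p (ℤ.+≤+ (s≤s (s≤s (z≤n {k})))) pp 3≤p
  with d₀ , isRank , d≤p ← Valuations.rank k pp 3≤p =
  F (suc d₀) , suc d₀ , s≤s z≤n , d≤p , Valuations.formula k pp 3≤p isRank
  where
  open Identities (+ (2 ℕ.+ k)) using (F)
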